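{- Fix an integer $b\ge 1$. For integers $N,L\ge 0$ let $J_{N,L}$ denote the number of jammed configurations of length $L$ (with blockade range $b$) having exactly $N$ ones. Then the bivariate generating function $F_b(x,y)=\sum_{N,L\ge 0} J_{N,L}\,x^N y^L$ equals $$F_b(x,y)=\frac{(1-y)^2+xy-xy^{b+1}-xy^{b+2}+xy^{2b+2}}{(1-y)\,(1-y-xy^{b+1}+xy^{2b+2})}.$$
   Context: A configuration of length $L$ is a word $w\in\{0,1\}^L$ (sites of a one-dimensional lattice; $1$ = atom excited to the Rydberg state, $0$ = neutral atom). Given the blockade range $b\ge1$, a configuration is admissible if any two ones in it are separated by at least $b$ zeros, and it is jammed if it is admissible and no zero can be changed into a one while keeping it admissible. Equivalently, a jammed configuration is either the empty word, or a word containing at least one $1$ in which every run of zeros between two consecutive ones has length between $b$ and $2b$, and the runs of zeros before the first one and after the last one have length at most $b$. In particular $J_{0,0}=1$ and $J_{0,L}=0$ for $L\ge1$. -}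

module Defs where

open import Data.Bool using (Bool; true; false)
open import Data.Nat using (ℕ; zero; suc; _+_; _∸_; _<_; _≤_)
import Data.Nat as ℕ
open import Data.Fin using (Fin; toℕ) renaming (_<_ to _<ᶠ_)
import Data.Fin as Fin
open import Data.Fin.Properties using (all?)
open import Data.Vec using (Vec; []; _∷_; lookup; _[_]≔_)
open import Data.List using (List; []; _∷_; _++_; map; length; filter)
open import Data.Integer using (ℤ; +_; -[1+_]) renaming (_+_ to _+ℤ_; _*_ to _*ℤ_; -_ to -ℤ_)
open import Data.Product using (_×_)
open import Relation.Nullary using (¬_; Dec; ¬?)
open import Relation.Nullary.Decidable using (_×-dec_; _→-dec_)
open import Relation.Binary.PropositionalEquality using (_≡_)
import Data.Bool.Properties as BoolP

-- A configuration of length L: a word w ∈ {0,1}^L (true = 1 = Rydberg excitation).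
Word : ℕ → Set
Word L = Vec Bool L

Admissible : (b : ℕ) {L : ℕ} → Word L → Set
Admissible b {L} w =
  (i j : Fin L) → i <ᶠ j → lookup w i ≡ true → lookup w j ≡ true → b ≤ (toℕ j ∸ toℕ i) ∸ 1

Jammed : (b : ℕ) {L : ℕ} → Word L → Set
Jammed b {L} w =
  Admissible b w × ((k : Fin L) → lookup w k ≡ false → ¬ Admissible b (w [ k ]≔ true))

admissible? : (b : ℕ) {L : ℕ} (w : Word L) → Dec (Admissible b w)
admissible? b w = all? λ i → all? λ j →
  (i Fin.<? j) →-dec (lookup w i BoolP.≟ true) →-dec (lookup w j BoolP.≟ true)
    →-dec (b ℕ.≤? _)

jammed? : (b : ℕ) {L : ℕ} (w : Word L) → Dec (Jammed b w)
jammed? b w = admissible? b w ×-dec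
  all? (λ k → (lookup w k BoolP.≟ false) →-dec ¬? (admissible? b (w [ k ]≔ true)))

ones : {L : ℕ} → Word L → ℕ
ones [] = 0
ones (true ∷ w) = suc (ones w)
ones (false ∷ w) = ones w

allWords : (L : ℕ) → List (Word L)
allWords zero = [] ∷ []
allWords (suc L) = map (false ∷_) (allWords L) ++ map (true ∷_) (allWords L)

J : (b N L : ℕ) → ℕ
J b N L = length (filter (λ w → jammed? b w ×-dec (ones w ℕ.≟ N)) (allWords L))

-- Formal bivariate power series over ℤ: coefficient functions (N , L) ↦ c_{N,L}
-- (coefficient of x^N y^L).

Series : Set
Series = ℕ → ℕ → ℤ

sumTo : ℕ → (ℕ → ℤ) → ℤ
sumTo zero f = f 0
sumTo (suc n) f = sumTo n f +ℤ f (suc n)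

infixl 6 _⊕_ _⊖_
infixl 7 _⊗_

_⊕_ : Series → Series → Series
(f ⊕ g) N L = f N L +ℤ g N L

_⊖_ : Series → Series → Series
(f ⊖ g) N L = f N L +ℤ -ℤ (g N L)

_⊗_ : Series → Series → Series
(f ⊗ g) N L = sumTo N λ i → sumTo L λ j → f i j *ℤ g (N ∸ i) (L ∸ j)

mono : ℕ → ℕ → Series
mono a c N L with a ℕ.≟ N | c ℕ.≟ L
... | Relation.Nullary.yes _ | Relation.Nullary.yes _ = + 1
... | _ | _ = + 0

𝟙 𝕩 𝕪 : Series
𝟙 = mono 0 0
𝕩 = mono 1 0
𝕪 = mono 0 1

𝕪^ : ℕ → Series
𝕪^ n = mono 0 n

F : ℕ → Series
F b N L = + (J b N L)

numer : ℕ → Series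
numer b = (𝟙 ⊖ 𝕪) ⊗ (𝟙 ⊖ 𝕪) ⊕ 𝕩 ⊗ 𝕪 ⊖ 𝕩 ⊗ 𝕪^ (b + 1) ⊖ 𝕩 ⊗ 𝕪^ (b + 2) ⊕ 𝕩 ⊗ 𝕪^ (2 ℕ.* b + 2)

denom : ℕ → Series
denom b = (𝟙 ⊖ 𝕪) ⊗ (𝟙 ⊖ 𝕪 ⊖ 𝕩 ⊗ 𝕪^ (b + 1) ⊕ 𝕩 ⊗ 𝕪^ (2 ℕ.* b + 2))

-- A jammed word stays jammed when cut at one of its ones, and two jammed words sharing a
-- one glue to a jammed word. So the jammed completions of a prefix depend only on the zeros
-- after its last one: their series Z a (after a leading zeros, a ≤ b) and O g (after a one
-- and g zeros, g ≤ 2b) satisfy linear recurrences in the shifts x·, y·. Solving them with the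
-- geometric sums 1 + y + ⋯ + y^(n-1) gives F = 1 + x y (1 + ⋯ + y^b) O₀ and
-- (1 - y - x y^(b+1) + x y^(2b+2)) O₀ = 1 - y^(b+1); multiplying F by the denominator then
-- leaves the numerator.

module Submission where

open import Data.Bool using (Bool; true; false)
open import Data.Empty using (⊥-elim)
open import Data.Fin using (Fin; toℕ)
import Data.Fin as Fin
open import Data.Integer using (ℤ; +_) renaming (_+_ to _+ℤ_; _*_ to _*ℤ_; -_ to -ℤ_)
import Data.Integer.Properties as ℤ
open import Algebra.Properties.CommutativeSemigroup ℤ.+-commutativeSemigroup
  using () renaming (interchange to +-interchange)
open import Data.Integer.Tactic.RingSolver using (solve-∀)
import Data.Nat.Tactic.RingSolver as ℕ-Ring
open import Data.List using (List; []; _∷_; _++_; _∷ʳ_; length; replicate; filter; map)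
import Data.List.Properties as List
open import Data.List.Relation.Unary.All using (universal)
open import Data.Nat using (ℕ; zero; suc; _+_; _∸_; _≤_; _<_; z≤n; s≤s; z<s)
import Data.Nat as ℕ
import Data.Nat.Properties as ℕ
open import Data.Product using (_×_; _,_; proj₁; ∃-syntax; Σ-syntax)
open import Data.Sum using (_⊎_; inj₁; inj₂)
open import Data.Vec using (_∷_; lookup; _[_]≔_; toList; fromList)
import Data.Vec.Properties as Vec
open import Function using (id; _∘_)
open import Function.Bundles using (_⇔_; mk⇔; Equivalence)
open import Level using (0ℓ)
open import Relation.Binary.Bundles using (Setoid)
open import Relation.Binary.Definitions using (tri<; tri≈; tri>)
open import Relation.Binary.Structures using (IsEquivalence)
import Relation.Binary.Reasoning.Setoid as SetoidReasoning
open import Relation.Binary.PropositionalEquality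
  using (_≡_; _≢_; refl; sym; trans; cong; cong₂; subst; module ≡-Reasoning)
open import Relation.Nullary using (¬_; Dec; yes; no)
open import Relation.Nullary.Decidable using (_×-dec_)
import Relation.Nullary.Decidable as Dec
open import Relation.Unary using (Pred; Decidable)

open import Defs

sumTo-cong : ∀ n {f g : ℕ → ℤ} → (∀ i → i ≤ n → f i ≡ g i) → sumTo n f ≡ sumTo n g
sumTo-cong zero e = e 0 z≤n
sumTo-cong (suc n) e =
  cong₂ _+ℤ_ (sumTo-cong n (λ i i≤n → e i (ℕ.m≤n⇒m≤1+n i≤n))) (e (suc n) ℕ.≤-refl)

sumTo-zero : ∀ n → sumTo n (λ _ → + 0) ≡ + 0
sumTo-zero zero = refl
sumTo-zero (suc n) = cong (_+ℤ + 0) (sumTo-zero n)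

sumTo-+ : ∀ n (f g : ℕ → ℤ) → sumTo n (λ i → f i +ℤ g i) ≡ sumTo n f +ℤ sumTo n g
sumTo-+ zero f g = refl
sumTo-+ (suc n) f g = trans (cong (_+ℤ (f (suc n) +ℤ g (suc n))) (sumTo-+ n f g))
                            (+-interchange (sumTo n f) (sumTo n g) (f (suc n)) (g (suc n)))

sumTo-neg : ∀ n (f : ℕ → ℤ) → sumTo n (λ i → -ℤ f i) ≡ -ℤ sumTo n f
sumTo-neg zero f = refl
sumTo-neg (suc n) f = trans (cong (_+ℤ -ℤ f (suc n)) (sumTo-neg n f))
                            (sym (ℤ.neg-distrib-+ (sumTo n f) (f (suc n))))

sumTo-last : ∀ n (f : ℕ → ℤ) → (∀ i → i < n → f i ≡ + 0) → sumTo n f ≡ f n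
sumTo-last zero f _ = refl
sumTo-last (suc n) f z = begin
  sumTo n f +ℤ f (suc n)          ≡⟨ cong (_+ℤ f (suc n)) (sumTo-cong n (λ i i≤n → z i (s≤s i≤n))) ⟩
  sumTo n (λ _ → + 0) +ℤ f (suc n) ≡⟨ cong (_+ℤ f (suc n)) (sumTo-zero n) ⟩
  + 0 +ℤ f (suc n)                ≡⟨ ℤ.+-identityˡ (f (suc n)) ⟩
  f (suc n)                       ∎
  where open ≡-Reasoning

sumTo-*-zero : ∀ n (f : ℕ → ℤ) → sumTo n (λ i → f i *ℤ + 0) ≡ + 0
sumTo-*-zero n f = trans (sumTo-cong n (λ i _ → ℤ.*-zeroʳ (f i))) (sumTo-zero n)

sumTo-∸-suc : ∀ n (h : ℕ → ℕ → ℤ) → (∀ i → h i 0 ≡ + 0) →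
              sumTo (suc n) (λ i → h i (suc n ∸ i)) ≡ sumTo n (λ i → h i (suc (n ∸ i)))
sumTo-∸-suc n h h0 = begin
  sumTo n (λ i → h i (suc n ∸ i)) +ℤ h (suc n) (n ∸ n)
    ≡⟨ cong₂ _+ℤ_ (sumTo-cong n (λ i i≤n → cong (h i) (ℕ.+-∸-assoc 1 i≤n)))
                  (trans (cong (h (suc n)) (ℕ.n∸n≡0 n)) (h0 (suc n))) ⟩
  sumTo n (λ i → h i (suc (n ∸ i))) +ℤ + 0
    ≡⟨ ℤ.+-identityʳ _ ⟩
  sumTo n (λ i → h i (suc (n ∸ i))) ∎
  where open ≡-Reasoning

-- Formal power series

infix 4 _≈_
_≈_ : Series → Series → Set
f ≈ g = ∀ N L → f N L ≡ g N L

≈-isEquivalence : IsEquivalence _≈_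
≈-isEquivalence = record
  { refl = λ _ _ → refl
  ; sym = λ e N L → sym (e N L)
  ; trans = λ e e′ N L → trans (e N L) (e′ N L)
  }

≈-setoid : Setoid 0ℓ 0ℓ
≈-setoid = record { isEquivalence = ≈-isEquivalence }

open Setoid ≈-setoid using () renaming (refl to ≈-refl; sym to ≈-sym; trans to ≈-trans)
module ≈-Reasoning = SetoidReasoning ≈-setoid

𝟘 : Series
𝟘 _ _ = + 0

⊕-cong : ∀ {f f′ g g′} → f ≈ f′ → g ≈ g′ → f ⊕ g ≈ f′ ⊕ g′
⊕-cong e e′ N L = cong₂ _+ℤ_ (e N L) (e′ N L)

⊖-cong : ∀ {f f′ g g′} → f ≈ f′ → g ≈ g′ → f ⊖ g ≈ f′ ⊖ g′
⊖-cong e e′ N L = cong₂ (λ u v → u +ℤ -ℤ v) (e N L) (e′ N L)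

infixr 8 x·_ y·_ y^_·_

x·_ : Series → Series
(x· f) zero L = + 0
(x· f) (suc N) L = f N L

y·_ : Series → Series
(y· f) N zero = + 0
(y· f) N (suc L) = f N L

y^_·_ : ℕ → Series → Series
y^ zero · f = f
y^ suc n · f = y· y^ n · f

infixr 8 ⊝_

⊝_ : Series → Series
(⊝ f) N L = -ℤ f N L

⊕-interchange : ∀ f g h k → (f ⊕ g) ⊕ (h ⊕ k) ≈ (f ⊕ h) ⊕ (g ⊕ k)
⊕-interchange f g h k N L = +-interchange (f N L) (g N L) (h N L) (k N L)

⊖-interchange : ∀ f g h k → (f ⊖ g) ⊖ (h ⊖ k) ≈ (f ⊖ h) ⊖ (g ⊖ k)
⊖-interchange f g h k N L = lemma (f N L) (g N L) (h N L) (k N L)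
  where
  lemma : ∀ a b c d → (a +ℤ -ℤ b) +ℤ -ℤ (c +ℤ -ℤ d) ≡ (a +ℤ -ℤ c) +ℤ -ℤ (b +ℤ -ℤ d)
  lemma = solve-∀

⊕-⊖-interchange : ∀ f g h k → (f ⊕ g) ⊖ (h ⊕ k) ≈ (f ⊖ h) ⊕ (g ⊖ k)
⊕-⊖-interchange f g h k N L = lemma (f N L) (g N L) (h N L) (k N L)
  where
  lemma : ∀ a b c d → (a +ℤ b) +ℤ -ℤ (c +ℤ d) ≡ (a +ℤ -ℤ c) +ℤ (b +ℤ -ℤ d)
  lemma = solve-∀

⊖-⊕-interchange : ∀ f g h k → (f ⊖ g) ⊕ (h ⊖ k) ≈ (f ⊕ h) ⊖ (g ⊕ k)
⊖-⊕-interchange f g h k N L = lemma (f N L) (g N L) (h N L) (k N L)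
  where
  lemma : ∀ a b c d → (a +ℤ -ℤ b) +ℤ (c +ℤ -ℤ d) ≡ (a +ℤ c) +ℤ -ℤ (b +ℤ d)
  lemma = solve-∀

x·-cong : ∀ {f g} → f ≈ g → x· f ≈ x· g
x·-cong e zero L = refl
x·-cong e (suc N) L = e N L

y·-cong : ∀ {f g} → f ≈ g → y· f ≈ y· g
y·-cong e N zero = refl
y·-cong e N (suc L) = e N L

x·-⊕ : ∀ f g → x· (f ⊕ g) ≈ x· f ⊕ x· g
x·-⊕ f g zero L = refl
x·-⊕ f g (suc N) L = refl

x·-⊖ : ∀ f g → x· (f ⊖ g) ≈ x· f ⊖ x· g
x·-⊖ f g zero L = refl
x·-⊖ f g (suc N) L = refl

y·-⊕ : ∀ f g → y· (f ⊕ g) ≈ y· f ⊕ y· g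
y·-⊕ f g N zero = refl
y·-⊕ f g N (suc L) = refl

y·-⊖ : ∀ f g → y· (f ⊖ g) ≈ y· f ⊖ y· g
y·-⊖ f g N zero = refl
y·-⊖ f g N (suc L) = refl

x·-y·-comm : ∀ f → x· y· f ≈ y· x· f
x·-y·-comm f zero zero = refl
x·-y·-comm f zero (suc L) = refl
x·-y·-comm f (suc N) zero = refl
x·-y·-comm f (suc N) (suc L) = refl

y^-+ : ∀ m n f → y^ m · y^ n · f ≈ y^ (m + n) · f
y^-+ zero n f = ≈-refl
y^-+ (suc m) n f = y·-cong (y^-+ m n f)

⊗-congˡ : ∀ f {g h} → g ≈ h → f ⊗ g ≈ f ⊗ h
⊗-congˡ f e N L = sumTo-cong N (λ i _ → sumTo-cong L (λ j _ → cong (f i j *ℤ_) (e (N ∸ i) (L ∸ j))))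

⊗-distribˡ-⊕ : ∀ f g h → f ⊗ (g ⊕ h) ≈ f ⊗ g ⊕ f ⊗ h
⊗-distribˡ-⊕ f g h N L = begin
  sumTo N (λ i → sumTo L (λ j → f i j *ℤ (g (N ∸ i) (L ∸ j) +ℤ h (N ∸ i) (L ∸ j))))
    ≡⟨ sumTo-cong N (λ i _ → trans (sumTo-cong L (λ j _ → ℤ.*-distribˡ-+ (f i j) _ _)) (sumTo-+ L _ _)) ⟩
  sumTo N (λ i → sumTo L (λ j → f i j *ℤ g (N ∸ i) (L ∸ j)) +ℤ sumTo L (λ j → f i j *ℤ h (N ∸ i) (L ∸ j)))
    ≡⟨ sumTo-+ N _ _ ⟩
  (f ⊗ g) N L +ℤ (f ⊗ h) N L ∎
  where open ≡-Reasoning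

⊗-⊝ : ∀ f g → f ⊗ ⊝ g ≈ ⊝ (f ⊗ g)
⊗-⊝ f g N L = begin
  sumTo N (λ i → sumTo L (λ j → f i j *ℤ -ℤ g (N ∸ i) (L ∸ j)))
    ≡⟨ sumTo-cong N (λ i _ → trans (sumTo-cong L (λ j _ → sym (ℤ.neg-distribʳ-* (f i j) _))) (sumTo-neg L _)) ⟩
  sumTo N (λ i → -ℤ sumTo L (λ j → f i j *ℤ g (N ∸ i) (L ∸ j)))
    ≡⟨ sumTo-neg N _ ⟩
  -ℤ (f ⊗ g) N L ∎
  where open ≡-Reasoning

-- g ⊖ h and g ⊕ ⊝ h are definitionally equal.
⊗-distribˡ-⊖ : ∀ f g h → f ⊗ (g ⊖ h) ≈ f ⊗ g ⊖ f ⊗ h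
⊗-distribˡ-⊖ f g h = ≈-trans (⊗-distribˡ-⊕ f g (⊝ h)) (⊕-cong (≈-refl {f ⊗ g}) (⊗-⊝ f h))

⊗-x· : ∀ f g → f ⊗ x· g ≈ x· (f ⊗ g)
⊗-x· f g zero L = sumTo-*-zero L (f 0)
⊗-x· f g (suc N) L =
  sumTo-∸-suc N (λ i m → sumTo L (λ j → f i j *ℤ (x· g) m (L ∸ j))) (λ i → sumTo-*-zero L (f i))

⊗-y· : ∀ f g → f ⊗ y· g ≈ y· (f ⊗ g)
⊗-y· f g N zero = sumTo-*-zero N (λ i → f i 0)
⊗-y· f g N (suc L) =
  sumTo-cong N (λ i _ → sumTo-∸-suc L (λ j m → f i j *ℤ (y· g) (N ∸ i) m) (λ j → ℤ.*-zeroʳ (f i j)))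

⊗-identityʳ : ∀ f → f ⊗ 𝟙 ≈ f
⊗-identityʳ f N L = begin
  sumTo N (λ i → sumTo L (λ j → f i j *ℤ 𝟙 (N ∸ i) (L ∸ j)))
    ≡⟨ sumTo-last N _ earlier-rows-vanish ⟩
  sumTo L (λ j → f N j *ℤ 𝟙 (N ∸ N) (L ∸ j))
    ≡⟨ cong (λ m → sumTo L (λ j → f N j *ℤ 𝟙 m (L ∸ j))) (ℕ.n∸n≡0 N) ⟩
  sumTo L (λ j → f N j *ℤ 𝟙 0 (L ∸ j))
    ≡⟨ sumTo-last L _ earlier-columns-vanish ⟩
  f N L *ℤ 𝟙 0 (L ∸ L)
    ≡⟨ cong (λ m → f N L *ℤ 𝟙 0 m) (ℕ.n∸n≡0 L) ⟩
  f N L *ℤ + 1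
    ≡⟨ ℤ.*-identityʳ (f N L) ⟩
  f N L ∎
  where
  open ≡-Reasoning
  𝟙-≢0ˡ : ∀ {m} → m ≢ 0 → ∀ n → 𝟙 m n ≡ + 0
  𝟙-≢0ˡ {zero} m≢0 n = ⊥-elim (m≢0 refl)
  𝟙-≢0ˡ {suc m} _ n = refl
  𝟙-≢0ʳ : ∀ {n} → n ≢ 0 → 𝟙 0 n ≡ + 0
  𝟙-≢0ʳ {zero} n≢0 = ⊥-elim (n≢0 refl)
  𝟙-≢0ʳ {suc n} _ = refl
  earlier-rows-vanish : ∀ i → i < N → sumTo L (λ j → f i j *ℤ 𝟙 (N ∸ i) (L ∸ j)) ≡ + 0
  earlier-rows-vanish i i<N =
    trans (sumTo-cong L (λ j _ → cong (f i j *ℤ_) (𝟙-≢0ˡ (ℕ.m>n⇒m∸n≢0 i<N) (L ∸ j)))) (sumTo-*-zero L (f i))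
  earlier-columns-vanish : ∀ j → j < L → f N j *ℤ 𝟙 0 (L ∸ j) ≡ + 0
  earlier-columns-vanish j j<L = trans (cong (f N j *ℤ_) (𝟙-≢0ʳ (ℕ.m>n⇒m∸n≢0 j<L))) (ℤ.*-zeroʳ (f N j))

-- Multiplication by polynomials

record Multiplier (T : Series → Series) : Set where
  field
    ·-cong  : ∀ {f g} → f ≈ g → T f ≈ T g
    ⊕-homo  : ∀ f g → T (f ⊕ g) ≈ T f ⊕ T g
    ⊖-homo  : ∀ f g → T (f ⊖ g) ≈ T f ⊖ T g
    x·-comm : ∀ f → T (x· f) ≈ x· T f
    y·-comm : ∀ f → T (y· f) ≈ y· T f
    ⊗-comm  : ∀ f g → f ⊗ T g ≈ T (f ⊗ g)

id-multiplier : Multiplier id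
id-multiplier = record
  { ·-cong = id ; ⊕-homo = λ _ _ → ≈-refl ; ⊖-homo = λ _ _ → ≈-refl
  ; x·-comm = λ _ → ≈-refl ; y·-comm = λ _ → ≈-refl ; ⊗-comm = λ _ _ → ≈-refl }

x·-multiplier : Multiplier x·_
x·-multiplier = record
  { ·-cong = x·-cong ; ⊕-homo = x·-⊕ ; ⊖-homo = x·-⊖
  ; x·-comm = λ _ → ≈-refl ; y·-comm = x·-y·-comm ; ⊗-comm = ⊗-x· }

y·-multiplier : Multiplier y·_
y·-multiplier = record
  { ·-cong = y·-cong ; ⊕-homo = y·-⊕ ; ⊖-homo = y·-⊖
  ; x·-comm = λ f → ≈-sym (x·-y·-comm f) ; y·-comm = λ _ → ≈-refl ; ⊗-comm = ⊗-y· }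

module _ {T U : Series → Series} (T-mult : Multiplier T) (U-mult : Multiplier U) where
  private
    module T = Multiplier T-mult
    module U = Multiplier U-mult

  ∘-multiplier : Multiplier (T ∘ U)
  ∘-multiplier = record
    { ·-cong = T.·-cong ∘ U.·-cong
    ; ⊕-homo = λ f g → ≈-trans (T.·-cong (U.⊕-homo f g)) (T.⊕-homo _ _)
    ; ⊖-homo = λ f g → ≈-trans (T.·-cong (U.⊖-homo f g)) (T.⊖-homo _ _)
    ; x·-comm = λ f → ≈-trans (T.·-cong (U.x·-comm f)) (T.x·-comm _)
    ; y·-comm = λ f → ≈-trans (T.·-cong (U.y·-comm f)) (T.y·-comm _)
    ; ⊗-comm = λ f g → ≈-trans (T.⊗-comm f (U g)) (T.·-cong (U.⊗-comm f g))
    }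

  ⊕-multiplier : Multiplier (λ f → T f ⊕ U f)
  ⊕-multiplier = record
    { ·-cong = λ e → ⊕-cong (T.·-cong e) (U.·-cong e)
    ; ⊕-homo = λ f g → ≈-trans (⊕-cong (T.⊕-homo f g) (U.⊕-homo f g)) (⊕-interchange (T f) (T g) (U f) (U g))
    ; ⊖-homo = λ f g → ≈-trans (⊕-cong (T.⊖-homo f g) (U.⊖-homo f g)) (⊖-⊕-interchange (T f) (T g) (U f) (U g))
    ; x·-comm = λ f → ≈-trans (⊕-cong (T.x·-comm f) (U.x·-comm f)) (≈-sym (x·-⊕ (T f) (U f)))
    ; y·-comm = λ f → ≈-trans (⊕-cong (T.y·-comm f) (U.y·-comm f)) (≈-sym (y·-⊕ (T f) (U f)))
    ; ⊗-comm = λ f g → ≈-trans (⊗-distribˡ-⊕ f (T g) (U g)) (⊕-cong (T.⊗-comm f g) (U.⊗-comm f g))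
    }

  ⊖-multiplier : Multiplier (λ f → T f ⊖ U f)
  ⊖-multiplier = record
    { ·-cong = λ e → ⊖-cong (T.·-cong e) (U.·-cong e)
    ; ⊕-homo = λ f g → ≈-trans (⊖-cong (T.⊕-homo f g) (U.⊕-homo f g)) (⊕-⊖-interchange (T f) (T g) (U f) (U g))
    ; ⊖-homo = λ f g → ≈-trans (⊖-cong (T.⊖-homo f g) (U.⊖-homo f g)) (⊖-interchange (T f) (T g) (U f) (U g))
    ; x·-comm = λ f → ≈-trans (⊖-cong (T.x·-comm f) (U.x·-comm f)) (≈-sym (x·-⊖ (T f) (U f)))
    ; y·-comm = λ f → ≈-trans (⊖-cong (T.y·-comm f) (U.y·-comm f)) (≈-sym (y·-⊖ (T f) (U f)))
    ; ⊗-comm = λ f g → ≈-trans (⊗-distribˡ-⊖ f (T g) (U g)) (⊖-cong (T.⊗-comm f g) (U.⊗-comm f g))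
    }

y^-multiplier : ∀ n → Multiplier (y^ n ·_)
y^-multiplier zero = id-multiplier
y^-multiplier (suc n) = ∘-multiplier y·-multiplier (y^-multiplier n)

⊗-multiplier-𝟙 : ∀ {T} → Multiplier T → ∀ f → f ⊗ T 𝟙 ≈ T f
⊗-multiplier-𝟙 T-mult f = ≈-trans (⊗-comm f 𝟙) (·-cong (⊗-identityʳ f))
  where open Multiplier T-mult

multiplier-𝟘 : ∀ {T} → Multiplier T → T 𝟘 ≈ 𝟘
multiplier-𝟘 {T} T-mult N L = trans (⊖-homo 𝟘 𝟘 N L) (ℤ.+-inverseʳ (T 𝟘 N L))
  where open Multiplier T-mult

y^-comm : ∀ {T} → Multiplier T → ∀ n f → T (y^ n · f) ≈ y^ n · T f
y^-comm T-mult zero f = ≈-refl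
y^-comm T-mult (suc n) f = ≈-trans (y·-comm (y^ n · f)) (y·-cong (y^-comm T-mult n f))
  where open Multiplier T-mult

x·y^-multiplier : ∀ n → Multiplier (λ f → x· y^ n · f)
x·y^-multiplier n = ∘-multiplier x·-multiplier (y^-multiplier n)

y^-x·y^ : ∀ m n f → y^ m · x· y^ n · f ≈ x· y^ (m + n) · f
y^-x·y^ m n f = ≈-trans (Multiplier.x·-comm (y^-multiplier m) (y^ n · f)) (x·-cong (y^-+ m n f))

x·y^-≡ : ∀ {m n} → m ≡ n → ∀ f → x· y^ m · f ≈ x· y^ n · f
x·y^-≡ refl f = ≈-refl

infixr 8 [1-y]·_ P[_]·_

[1-y]·_ : Series → Series
[1-y]· f = f ⊖ y· f

-- The second factor of the denominator.
P[_]·_ : ℕ → Series → Series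
P[ b ]· f = [1-y]· f ⊖ x· y^ (b + 1) · f ⊕ x· y^ (2 ℕ.* b + 2) · f

[1-y]-multiplier : Multiplier [1-y]·_
[1-y]-multiplier = ⊖-multiplier id-multiplier y·-multiplier

P-multiplier : ∀ b → Multiplier P[ b ]·_
P-multiplier b =
  ⊕-multiplier (⊖-multiplier [1-y]-multiplier (∘-multiplier x·-multiplier (y^-multiplier (b + 1))))
               (∘-multiplier x·-multiplier (y^-multiplier (2 ℕ.* b + 2)))

mono-diag : ∀ a c → mono a c a c ≡ + 1
mono-diag a c with a ℕ.≟ a | c ℕ.≟ c
... | yes _ | yes _ = refl
... | no a≢a | _ = ⊥-elim (a≢a refl)
... | yes _ | no c≢c = ⊥-elim (c≢c refl)

mono-off : ∀ {a c N L} → a ≢ N ⊎ c ≢ L → mono a c N L ≡ + 0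
mono-off {a} {c} {N} {L} off with a ℕ.≟ N | c ℕ.≟ L | off
... | yes a≡N | yes c≡L | inj₁ a≢N = ⊥-elim (a≢N a≡N)
... | yes a≡N | yes c≡L | inj₂ c≢L = ⊥-elim (c≢L c≡L)
... | yes _ | no _ | _ = refl
... | no _ | _ | _ = refl

mono-y· : ∀ a c → mono a (suc c) ≈ y· mono a c
mono-y· a c N zero = mono-off (inj₂ (λ ()))
mono-y· a c N (suc L) = by-cases (a ℕ.≟ N) (c ℕ.≟ L)
  where
  by-cases : Dec (a ≡ N) → Dec (c ≡ L) → mono a (suc c) N (suc L) ≡ mono a c N L
  by-cases (yes a≡N) (yes c≡L) rewrite a≡N | c≡L = trans (mono-diag N (suc L)) (sym (mono-diag N L))
  by-cases (yes _) (no c≢L) = trans (mono-off (inj₂ (c≢L ∘ ℕ.suc-injective))) (sym (mono-off (inj₂ c≢L)))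
  by-cases (no a≢N) _ = trans (mono-off (inj₁ a≢N)) (sym (mono-off (inj₁ a≢N)))

𝕪^-≈ : ∀ k → 𝕪^ k ≈ y^ k · 𝟙
𝕪^-≈ zero = ≈-refl
𝕪^-≈ (suc k) = ≈-trans (mono-y· 0 k) (y·-cong (𝕪^-≈ k))

𝕩-≈ : 𝕩 ≈ x· 𝟙
𝕩-≈ zero L = refl
𝕩-≈ (suc zero) zero = refl
𝕩-≈ (suc zero) (suc L) = refl
𝕩-≈ (suc (suc N)) L = refl

𝕩⊗𝕪^-≈ : ∀ k → 𝕩 ⊗ 𝕪^ k ≈ x· y^ k · 𝟙
𝕩⊗𝕪^-≈ k = begin
  𝕩 ⊗ 𝕪^ k         ≈⟨ ⊗-congˡ 𝕩 (𝕪^-≈ k) ⟩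
  𝕩 ⊗ y^ k · 𝟙     ≈⟨ Multiplier.⊗-comm (y^-multiplier k) 𝕩 𝟙 ⟩
  y^ k · (𝕩 ⊗ 𝟙)   ≈⟨ Multiplier.·-cong (y^-multiplier k) (≈-trans (⊗-identityʳ 𝕩) 𝕩-≈) ⟩
  y^ k · x· 𝟙      ≈⟨ Multiplier.x·-comm (y^-multiplier k) 𝟙 ⟩
  x· y^ k · 𝟙      ∎
  where open ≈-Reasoning

𝟙⊖𝕪-≈ : 𝟙 ⊖ 𝕪 ≈ [1-y]· 𝟙
𝟙⊖𝕪-≈ = ⊖-cong (≈-refl {𝟙}) (𝕪^-≈ 1)

denom-≈ : ∀ b → denom b ≈ P[ b ]· [1-y]· 𝟙
denom-≈ b = begin
  (𝟙 ⊖ 𝕪) ⊗ (𝟙 ⊖ 𝕪 ⊖ 𝕩 ⊗ 𝕪^ (b + 1) ⊕ 𝕩 ⊗ 𝕪^ (2 ℕ.* b + 2))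
    ≈⟨ ⊗-congˡ (𝟙 ⊖ 𝕪) (⊕-cong (⊖-cong 𝟙⊖𝕪-≈ (𝕩⊗𝕪^-≈ (b + 1)))
                              (𝕩⊗𝕪^-≈ (2 ℕ.* b + 2))) ⟩
  (𝟙 ⊖ 𝕪) ⊗ P[ b ]· 𝟙
    ≈⟨ ⊗-multiplier-𝟙 (P-multiplier b) (𝟙 ⊖ 𝕪) ⟩
  P[ b ]· (𝟙 ⊖ 𝕪)
    ≈⟨ Multiplier.·-cong (P-multiplier b) 𝟙⊖𝕪-≈ ⟩
  P[ b ]· [1-y]· 𝟙 ∎
  where open ≈-Reasoning

⊗-denom : ∀ b f → f ⊗ denom b ≈ P[ b ]· [1-y]· f
⊗-denom b f = ≈-trans (⊗-congˡ f (denom-≈ b))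
                      (⊗-multiplier-𝟙 (∘-multiplier (P-multiplier b) [1-y]-multiplier) f)

numer-≈ : ∀ b → numer b ≈ [1-y]· [1-y]· 𝟙 ⊕ x· y^ 1 · 𝟙 ⊖ x· y^ (b + 1) · 𝟙
                              ⊖ x· y^ (b + 2) · 𝟙 ⊕ x· y^ (2 ℕ.* b + 2) · 𝟙
numer-≈ b =
  ⊕-cong (⊖-cong (⊖-cong (⊕-cong square (𝕩⊗𝕪^-≈ 1)) (𝕩⊗𝕪^-≈ (b + 1))) (𝕩⊗𝕪^-≈ (b + 2)))
         (𝕩⊗𝕪^-≈ (2 ℕ.* b + 2))
  where
  square : (𝟙 ⊖ 𝕪) ⊗ (𝟙 ⊖ 𝕪) ≈ [1-y]· [1-y]· 𝟙
  square = ≈-trans (⊗-congˡ (𝟙 ⊖ 𝕪) 𝟙⊖𝕪-≈)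
                   (≈-trans (⊗-multiplier-𝟙 [1-y]-multiplier (𝟙 ⊖ 𝕪))
                            (Multiplier.·-cong [1-y]-multiplier 𝟙⊖𝕪-≈))

geometric : ℕ → Series → Series
geometric zero f = 𝟘
geometric (suc n) f = y· geometric n f ⊕ f

geometric-chain : ∀ n (C : ℕ → Series) {E} → (∀ k → k < n → C k ≈ y· C (suc k) ⊕ E) →
                  C 0 ≈ y^ n · C n ⊕ geometric n E
geometric-chain zero C step N L = sym (ℤ.+-identityʳ (C 0 N L))
geometric-chain (suc n) C {E} step = begin
  C 0
    ≈⟨ step 0 (s≤s z≤n) ⟩
  y· C 1 ⊕ E
    ≈⟨ ⊕-cong (y·-cong (geometric-chain n (C ∘ suc) (λ k k<n → step (suc k) (s≤s k<n)))) (≈-refl {E}) ⟩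
  y· (y^ n · C (suc n) ⊕ geometric n E) ⊕ E
    ≈⟨ ⊕-cong (y·-⊕ (y^ n · C (suc n)) (geometric n E)) (≈-refl {E}) ⟩
  y^ suc n · C (suc n) ⊕ y· geometric n E ⊕ E
    ≈⟨ (λ N L → ℤ.+-assoc ((y^ suc n · C (suc n)) N L) _ _) ⟩
  y^ suc n · C (suc n) ⊕ geometric (suc n) E ∎
  where open ≈-Reasoning

[1-y]-geometric : ∀ n f → [1-y]· geometric n f ≈ f ⊖ y^ n · f
[1-y]-geometric zero f N L =
  trans (cong (λ v → + 0 +ℤ -ℤ v) (multiplier-𝟘 y·-multiplier N L)) (sym (ℤ.+-inverseʳ (f N L)))
[1-y]-geometric (suc n) f = begin
  [1-y]· (y· geometric n f ⊕ f)
    ≈⟨ ⊕-homo (y· geometric n f) f ⟩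
  [1-y]· y· geometric n f ⊕ [1-y]· f
    ≈⟨ ⊕-cong (≈-trans (y·-comm (geometric n f)) (y·-cong ([1-y]-geometric n f))) (≈-refl {[1-y]· f}) ⟩
  y· (f ⊖ y^ n · f) ⊕ [1-y]· f
    ≈⟨ ⊕-cong (y·-⊖ f (y^ n · f)) (≈-refl {[1-y]· f}) ⟩
  (y· f ⊖ y^ suc n · f) ⊕ (f ⊖ y· f)
    ≈⟨ (λ N L → telescope ((y· f) N L) ((y^ suc n · f) N L) (f N L)) ⟩
  f ⊖ y^ suc n · f ∎
  where
  open ≈-Reasoning
  open Multiplier [1-y]-multiplier
  telescope : ∀ a b c → (a +ℤ -ℤ b) +ℤ (c +ℤ -ℤ a) ≡ c +ℤ -ℤ b
  telescope = solve-∀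

geometric-dead-end : ∀ n (C : ℕ → Series) {E} → (∀ k → k < n → C k ≈ y· C (suc k) ⊕ E) → C n ≈ 𝟘 →
                     C 0 ≈ geometric n E
geometric-dead-end n C {E} step dead = begin
  C 0                         ≈⟨ geometric-chain n C step ⟩
  y^ n · C n ⊕ geometric n E  ≈⟨ ⊕-cong y^n·Cn≈𝟘 (≈-refl {geometric n E}) ⟩
  𝟘 ⊕ geometric n E           ≈⟨ (λ N L → ℤ.+-identityˡ (geometric n E N L)) ⟩
  geometric n E               ∎
  where
  open ≈-Reasoning
  y^n·Cn≈𝟘 : y^ n · C n ≈ 𝟘
  y^n·Cn≈𝟘 = ≈-trans (Multiplier.·-cong (y^-multiplier n) dead) (multiplier-𝟘 (y^-multiplier n))

-- Jammed words as lists

-- Words are handled as lists with ℕ positions, so that they can be cut and concatenated.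
at : List Bool → ℕ → Bool
at [] _ = false
at (x ∷ u) zero = x
at (x ∷ u) (suc i) = at u i

bit-clash : ∀ {A : Set} {x} → x ≡ true → x ≡ false → A
bit-clash refl ()

at-true-< : ∀ u {i} → at u i ≡ true → i < length u
at-true-< (x ∷ u) {zero} _ = z<s
at-true-< (x ∷ u) {suc i} e = s≤s (at-true-< u e)

occupy : List Bool → ℕ → List Bool
occupy [] _ = []
occupy (_ ∷ u) zero = true ∷ u
occupy (x ∷ u) (suc k) = x ∷ occupy u k

at-occupy-≡ : ∀ u {k} → k < length u → at (occupy u k) k ≡ true
at-occupy-≡ (x ∷ u) {zero} _ = refl
at-occupy-≡ (x ∷ u) {suc k} (s≤s k<) = at-occupy-≡ u k<

at-occupy-≢ : ∀ u {i k} → i ≢ k → at (occupy u k) i ≡ at u i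
at-occupy-≢ [] _ = refl
at-occupy-≢ (x ∷ u) {zero} {zero} i≢k = ⊥-elim (i≢k refl)
at-occupy-≢ (x ∷ u) {zero} {suc k} _ = refl
at-occupy-≢ (x ∷ u) {suc i} {zero} _ = refl
at-occupy-≢ (x ∷ u) {suc i} {suc k} i≢k = at-occupy-≢ u (i≢k ∘ cong suc)

lookup-at : ∀ {L} (w : Word L) i → lookup w i ≡ at (toList w) (toℕ i)
lookup-at (x ∷ w) Fin.zero = refl
lookup-at (x ∷ w) (Fin.suc i) = lookup-at w i

toList-[]≔true : ∀ {L} (w : Word L) k → toList (w [ k ]≔ true) ≡ occupy (toList w) (toℕ k)
toList-[]≔true (x ∷ w) Fin.zero = refl
toList-[]≔true (x ∷ w) (Fin.suc k) = cong (x ∷_) (toList-[]≔true w k)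

toℕ-<-length : ∀ {L} (w : Word L) (k : Fin L) → toℕ k < length (toList w)
toℕ-<-length (x ∷ w) Fin.zero = z<s
toℕ-<-length (x ∷ w) (Fin.suc k) = s≤s (toℕ-<-length w k)

<-length-toℕ⁻¹ : ∀ {L} (w : Word L) {k} → k < length (toList w) → Σ[ i ∈ Fin L ] toℕ i ≡ k
<-length-toℕ⁻¹ (x ∷ w) {zero} _ = Fin.zero , refl
<-length-toℕ⁻¹ (x ∷ w) {suc k} (s≤s k<) with <-length-toℕ⁻¹ w k<
... | i , refl = Fin.suc i , refl

∸-gap⇒< : ∀ {b} i {j} → i < j → b ≤ j ∸ i ∸ 1 → i + b < j
∸-gap⇒< zero {suc j} _ b≤ = s≤s b≤
∸-gap⇒< (suc i) {suc j} (s≤s i<j) b≤ = s≤s (∸-gap⇒< i i<j b≤)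

<⇒∸-gap : ∀ {b} i {j} → i + b < j → b ≤ j ∸ i ∸ 1
<⇒∸-gap zero {suc j} (s≤s b≤j) = b≤j
<⇒∸-gap (suc i) {suc j} (s≤s i+b<j) = <⇒∸-gap i i+b<j

at-++-∷ : ∀ u {x v w i} → i ≤ length u → at (u ++ x ∷ v) i ≡ at (u ++ x ∷ w) i
at-++-∷ [] {i = zero} _ = refl
at-++-∷ (y ∷ u) {i = zero} _ = refl
at-++-∷ (y ∷ u) {i = suc i} (s≤s i≤) = at-++-∷ u i≤

at-++-+ : ∀ u {v i} → at (u ++ v) (length u + i) ≡ at v i
at-++-+ [] = refl
at-++-+ (x ∷ u) = at-++-+ u

at-++-length : ∀ u {x v} → at (u ++ x ∷ v) (length u) ≡ x
at-++-length [] = refl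
at-++-length (y ∷ u) = at-++-length u

<-length-∷ʳ : ∀ (u : List Bool) {x : Bool} {k} → k < length (u ++ x ∷ []) → k ≤ length u
<-length-∷ʳ [] (s≤s z≤n) = z≤n
<-length-∷ʳ (y ∷ u) {k = zero} _ = z≤n
<-length-∷ʳ (y ∷ u) {k = suc k} (s≤s k<) = s≤s (<-length-∷ʳ u k<)

length<length-∷ʳ : ∀ (u : List Bool) {x : Bool} → length u < length (u ++ x ∷ [])
length<length-∷ʳ [] = z<s
length<length-∷ʳ (y ∷ u) = s≤s (length<length-∷ʳ u)

data Split (m : ℕ) : ℕ → Set where
  before : ∀ {i} → i < m → Split m i
  after  : ∀ i → Split m (m + i)

split : ∀ m i → Split m i
split zero i = after i
split (suc m) zero = before z<s
split (suc m) (suc i) with split m i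
... | before i<m = before (s≤s i<m)
... | after i = after i

zeros : ℕ → List Bool
zeros n = replicate n false

at-zeros : ∀ a {i} → at (zeros a) i ≡ false
at-zeros zero = refl
at-zeros (suc a) {zero} = refl
at-zeros (suc a) {suc i} = at-zeros a

at-zeros-++-< : ∀ a {l i} → i < a → at (zeros a ++ l) i ≡ false
at-zeros-++-< (suc a) {i = zero} _ = refl
at-zeros-++-< (suc a) {i = suc i} (s≤s i<a) = at-zeros-++-< a i<a

at-zeros-++-∷ : ∀ a {x l} → at (zeros a ++ x ∷ l) a ≡ x
at-zeros-++-∷ zero = refl
at-zeros-++-∷ (suc a) = at-zeros-++-∷ a

at-zeros-++ : ∀ a {l i} → at (zeros a ++ l) i ≡ true → ∃[ i′ ] i ≡ a + i′ × at l i′ ≡ true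
at-zeros-++ zero {i = i} li = i , refl , li
at-zeros-++ (suc a) {i = zero} ()
at-zeros-++ (suc a) {i = suc i} li with at-zeros-++ a li
... | i′ , refl , li′ = i′ , refl , li′

at-zeros-∷ʳ : ∀ a {i} → at (zeros a ++ true ∷ []) i ≡ true → i ≡ a
at-zeros-∷ʳ zero {zero} _ = refl
at-zeros-∷ʳ zero {suc i} ()
at-zeros-∷ʳ (suc a) {zero} ()
at-zeros-∷ʳ (suc a) {suc i} e = cong suc (at-zeros-∷ʳ a e)

<-length-zeros-++ : ∀ {a l i} → i < a → i < length (zeros a ++ l)
<-length-zeros-++ {suc a} {i = zero} _ = z<s
<-length-zeros-++ {suc a} {i = suc i} (s≤s i<a) = s≤s (<-length-zeros-++ i<a)

<-length-zeros-∷ʳ : ∀ {a k} {x : Bool} → k < length (zeros a ++ x ∷ []) → k ≤ a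
<-length-zeros-∷ʳ {zero} (s≤s z≤n) = z≤n
<-length-zeros-∷ʳ {suc a} {zero} _ = z≤n
<-length-zeros-∷ʳ {suc a} {suc k} (s≤s k<) = s≤s (<-length-zeros-∷ʳ k<)

zeros-∷ʳ : ∀ a → zeros a ∷ʳ false ≡ zeros (suc a)
zeros-∷ʳ zero = refl
zeros-∷ʳ (suc a) = cong (false ∷_) (zeros-∷ʳ a)

module _ (b : ℕ) where

  Far : ℕ → ℕ → Set
  Far i k = i + b < k ⊎ k + b < i

  Admissibleₗ : List Bool → Set
  Admissibleₗ u = ∀ {i j} → i < j → at u i ≡ true → at u j ≡ true → i + b < j

  Vacant : List Bool → ℕ → Set
  Vacant u k = ∀ {i} → at u i ≡ true → Far i k

  Saturated : List Bool → Set
  Saturated u = ∀ {k} → k < length u → at u k ≡ false → ¬ Vacant u k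

  Jammedₗ : List Bool → Set
  Jammedₗ u = Admissibleₗ u × Saturated u

  Far-< : ∀ {i k} → i < k → Far i k → i + b < k
  Far-< _ (inj₁ i+b<k) = i+b<k
  Far-< i<k (inj₂ k+b<i) = ⊥-elim (ℕ.<-asym i<k (ℕ.≤-<-trans (ℕ.m≤m+n _ b) k+b<i))

  Far-> : ∀ {i k} → k < i → Far i k → k + b < i
  Far-> k<i (inj₁ i+b<k) = ⊥-elim (ℕ.<-asym k<i (ℕ.≤-<-trans (ℕ.m≤m+n _ b) i+b<k))
  Far-> _ (inj₂ k+b<i) = k+b<i

  admissible⇒admissibleₗ : ∀ {L} (w : Word L) → Admissible b w → Admissibleₗ (toList w)
  admissible⇒admissibleₗ w adm {i} {j} i<j wi wj
    with <-length-toℕ⁻¹ w {i} (at-true-< (toList w) wi) | <-length-toℕ⁻¹ w {j} (at-true-< (toList w) wj)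
  ... | fi , refl | fj , refl =
    ∸-gap⇒< (toℕ fi) i<j (adm fi fj i<j (trans (lookup-at w fi) wi) (trans (lookup-at w fj) wj))

  admissibleₗ⇒admissible : ∀ {L} (w : Word L) → Admissibleₗ (toList w) → Admissible b w
  admissibleₗ⇒admissible w adm fi fj fi<fj wi wj =
    <⇒∸-gap (toℕ fi) (adm fi<fj (trans (sym (lookup-at w fi)) wi) (trans (sym (lookup-at w fj)) wj))

  vacant⇒admissible-occupy : ∀ {u k} → Admissibleₗ u → Vacant u k → Admissibleₗ (occupy u k)
  vacant⇒admissible-occupy {u} {k} adm vac {i} {j} i<j ui uj with i ℕ.≟ k | j ℕ.≟ k
  ... | yes refl | yes refl = ⊥-elim (ℕ.<-irrefl refl i<j)
  ... | yes refl | no j≢k = Far-> i<j (vac (trans (sym (at-occupy-≢ u j≢k)) uj))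
  ... | no i≢k | yes refl = Far-< i<j (vac (trans (sym (at-occupy-≢ u i≢k)) ui))
  ... | no i≢k | no j≢k = adm i<j (trans (sym (at-occupy-≢ u i≢k)) ui) (trans (sym (at-occupy-≢ u j≢k)) uj)

  admissible-occupy⇒vacant : ∀ {u k} → k < length u → at u k ≡ false → Admissibleₗ (occupy u k) →
                             Vacant u k
  admissible-occupy⇒vacant {u} {k} k<len uk adm {i} ui with ℕ.<-cmp i k
  ... | tri< i<k i≢k _ = inj₁ (adm i<k (trans (at-occupy-≢ u i≢k) ui) (at-occupy-≡ u k<len))
  ... | tri≈ _ refl _ = bit-clash ui uk
  ... | tri> _ i≢k k<i = inj₂ (adm k<i (at-occupy-≡ u k<len) (trans (at-occupy-≢ u i≢k) ui))

  jammed⇔jammedₗ : ∀ {L} (w : Word L) → Jammed b w ⇔ Jammedₗ (toList w)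
  jammed⇔jammedₗ w = mk⇔ to from
    where
    to : Jammed b w → Jammedₗ (toList w)
    to (adm , blocked) = admₗ , saturated
      where
      admₗ = admissible⇒admissibleₗ w adm
      saturated : Saturated (toList w)
      saturated {k} k<len wk vac with <-length-toℕ⁻¹ w {k} k<len
      ... | fk , refl =
        blocked fk (trans (lookup-at w fk) wk) (admissibleₗ⇒admissible (w [ fk ]≔ true)
          (subst Admissibleₗ (sym (toList-[]≔true w fk)) (vacant⇒admissible-occupy {toList w} admₗ vac)))
    from : Jammedₗ (toList w) → Jammed b w
    from (admₗ , saturated) = admissibleₗ⇒admissible w admₗ , blocked
      where
      blocked : ∀ fk → lookup w fk ≡ false → ¬ Admissible b (w [ fk ]≔ true)
      blocked fk wk adm = saturated (toℕ-<-length w fk) wk′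
        (admissible-occupy⇒vacant {toList w} (toℕ-<-length w fk) wk′
          (subst Admissibleₗ (toList-[]≔true w fk) (admissible⇒admissibleₗ (w [ fk ]≔ true) adm)))
        where wk′ = trans (sym (lookup-at w fk)) wk

  shift-< : ∀ m {i j} → i + b < j → (m + i) + b < m + j
  shift-< m {i} {j} i+b<j = subst (_< m + j) (sym (ℕ.+-assoc m i b)) (ℕ.+-monoʳ-< m i+b<j)

  shift-<⁻¹ : ∀ m {i j} → (m + i) + b < m + j → i + b < j
  shift-<⁻¹ m {i} {j} lt = ℕ.+-cancelˡ-< m (i + b) j (subst (_< m + j) (ℕ.+-assoc m i b) lt)

  Far-shift : ∀ m {i k} → Far i k → Far (m + i) (m + k)
  Far-shift m (inj₁ lt) = inj₁ (shift-< m lt)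
  Far-shift m (inj₂ lt) = inj₂ (shift-< m lt)

  Far-shift⁻¹ : ∀ m {i k} → Far (m + i) (m + k) → Far i k
  Far-shift⁻¹ m (inj₁ lt) = inj₁ (shift-<⁻¹ m lt)
  Far-shift⁻¹ m (inj₂ lt) = inj₂ (shift-<⁻¹ m lt)

  module _ (u : List Bool) {v : List Bool} where
    private
      m = length u
      W = u ++ true ∷ v
      U = u ++ true ∷ []
      V = true ∷ v

      W≡U : ∀ {i} → i ≤ m → at W i ≡ at U i
      W≡U = at-++-∷ u

      W≡V : ∀ {i} → at W (m + i) ≡ at V i
      W≡V = at-++-+ u

      <-length-W : ∀ {k} → k < length V → m + k < length W
      <-length-W k< = subst (_ <_) (sym (List.length-++ u)) (ℕ.+-monoʳ-< m k<)

    jammed-suffix : Jammedₗ W → Jammedₗ V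
    jammed-suffix (adm , sat) = admV , satV
      where
      admV : Admissibleₗ V
      admV i<j vi vj = shift-<⁻¹ m (adm (ℕ.+-monoʳ-< m i<j) (trans W≡V vi) (trans W≡V vj))
      satV : Saturated V
      satV {zero} _ ()
      satV {suc k} k<len vk vac = sat (<-length-W k<len) (trans W≡V vk) vacW
        where
        vacW : Vacant W (m + suc k)
        vacW {i} wi with split m i
        ... | before i<m = inj₁ (ℕ.+-mono-< i<m (Far-< z<s (vac refl)))
        ... | after i′ = Far-shift m (vac (trans (sym W≡V) wi))

    jammed-glue : Jammedₗ U → Jammedₗ V → Jammedₗ W
    jammed-glue (admU , satU) (admV , satV) = admW , satW
      where
      admW : Admissibleₗ W
      admW {i} {j} i<j wi wj with split m j
      ... | before j<m =
        admU i<j (trans (sym (W≡U (ℕ.<⇒≤ (ℕ.<-trans i<j j<m)))) wi) (trans (sym (W≡U (ℕ.<⇒≤ j<m))) wj)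
      ... | after j′ with split m i
      ...   | before i<m =
        ℕ.<-≤-trans (admU i<m (trans (sym (W≡U (ℕ.<⇒≤ i<m))) wi) (at-++-length u)) (ℕ.m≤m+n m j′)
      ...   | after i′ =
        shift-< m (admV (ℕ.+-cancelˡ-< m _ _ i<j) (trans (sym W≡V) wi) (trans (sym W≡V) wj))
      satW : Saturated W
      satW {k} k<len wk vac with split m k
      ... | before k<m =
        satU (ℕ.<-trans k<m (length<length-∷ʳ u)) (trans (sym (W≡U (ℕ.<⇒≤ k<m))) wk)
             (λ ui → vac (trans (W≡U (<-length-∷ʳ u (at-true-< U ui))) ui))
      ... | after k′ =
        satV (ℕ.+-cancelˡ-< m _ _ (subst (_ <_) (List.length-++ u) k<len)) (trans (sym W≡V) wk)
             (λ vi → Far-shift⁻¹ m (vac (trans W≡V vi)))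

  []-jammed : Jammedₗ []
  []-jammed = (λ _ ()) , (λ ())

  zeros-gap : ∀ a {l} → (∀ {i} → at l i ≡ true → b < suc a + i) → ¬ Jammedₗ (zeros (suc a) ++ l)
  zeros-gap a {l} far (_ , sat) = sat z<s refl vac
    where
    vac : Vacant (zeros (suc a) ++ l) 0
    vac {i} ui with at-zeros-++ (suc a) {i = i} ui
    ... | _ , refl , li = inj₂ (far li)

  zeros-unjammed : ∀ a → ¬ Jammedₗ (zeros (suc a))
  zeros-unjammed a = zeros-gap a (λ ()) ∘ subst Jammedₗ (sym (List.++-identityʳ (zeros (suc a))))

  long-zeros : ∀ {a l} → b < a → ¬ Jammedₗ (zeros a ++ l)
  long-zeros {suc a} b<a = zeros-gap a (λ {i} _ → ℕ.<-≤-trans b<a (ℕ.m≤m+n (suc a) i))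

  one-zeros-gap : ∀ {g l} → b < g → (∀ {i} → at l i ≡ true → b + b < g + i) →
                  ¬ Jammedₗ (true ∷ zeros g ++ l)
  one-zeros-gap {g} {l} b<g far (_ , sat) = sat (s≤s (<-length-zeros-++ b<g)) (at-zeros-++-< g b<g) vac
    where
    vac : Vacant (true ∷ zeros g ++ l) (suc b)
    vac {zero} _ = inj₁ (ℕ.n<1+n b)
    vac {suc i} ui with at-zeros-++ g {i = i} ui
    ... | _ , refl , li = inj₂ (s≤s (far li))

  one-zeros-unjammed : ∀ {g} → b < g → ¬ Jammedₗ (true ∷ zeros g)
  one-zeros-unjammed {g} b<g =
    one-zeros-gap b<g (λ ()) ∘ subst (λ u → Jammedₗ (true ∷ u)) (sym (List.++-identityʳ (zeros g)))

  long-gap : ∀ {g l} → b + b < g → ¬ Jammedₗ (true ∷ zeros g ++ l)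
  long-gap {g} b+b<g =
    one-zeros-gap (ℕ.≤-<-trans (ℕ.m≤m+n b b) b+b<g) (λ {i} _ → ℕ.<-≤-trans b+b<g (ℕ.m≤m+n g i))

  short-gap : ∀ {g l} → g < b → ¬ Admissibleₗ (true ∷ zeros g ++ true ∷ l)
  short-gap {g} g<b adm = ℕ.<⇒≱ g<b (ℕ.≤-pred (adm {0} {suc g} z<s refl (at-zeros-++-∷ g)))

  one-zeros-jammed : ∀ {g} → g ≤ b → Jammedₗ (true ∷ zeros g)
  one-zeros-jammed {g} g≤b = adm , sat
    where
    adm : Admissibleₗ (true ∷ zeros g)
    adm {j = zero} () _ _
    adm {j = suc j} _ _ uj = bit-clash uj (at-zeros g)
    sat : Saturated (true ∷ zeros g)
    sat {zero} _ ()
    sat {suc k} (s≤s k<) _ vac with vac {0} refl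
    ... | inj₁ (s≤s b≤k) =
      ℕ.<⇒≱ (subst (k <_) (List.length-replicate g) k<) (ℕ.≤-trans g≤b b≤k)

  zeros-one-jammed : ∀ {a} → a ≤ b → Jammedₗ (zeros a ++ true ∷ [])
  zeros-one-jammed {a} a≤b = adm , sat
    where
    adm : Admissibleₗ (zeros a ++ true ∷ [])
    adm {i} {j} i<j ui uj with at-zeros-∷ʳ a {i} ui | at-zeros-∷ʳ a {j} uj
    ... | refl | refl = ⊥-elim (ℕ.<-irrefl refl i<j)
    sat : Saturated (zeros a ++ true ∷ [])
    sat {k} k<len _ vac with vac (at-zeros-++-∷ a)
    ... | inj₁ a+b<k = ℕ.<⇒≱ a+b<k (ℕ.≤-trans (<-length-zeros-∷ʳ k<len) (ℕ.m≤m+n a b))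
    ... | inj₂ k+b<a = ℕ.<⇒≱ k+b<a (ℕ.≤-trans a≤b (ℕ.m≤n+m b k))

  one-zeros-one-jammed : ∀ {g} → b ≤ g → g ≤ b + b → Jammedₗ (true ∷ zeros g ++ true ∷ [])
  one-zeros-one-jammed {g} b≤g g≤b+b = adm , sat
    where
    adm : Admissibleₗ (true ∷ zeros g ++ true ∷ [])
    adm {j = zero} () _ _
    adm {zero} {suc j} _ _ uj with at-zeros-∷ʳ g {j} uj
    ... | refl = s≤s b≤g
    adm {suc i} {suc j} i<j ui uj with at-zeros-∷ʳ g {i} ui | at-zeros-∷ʳ g {j} uj
    ... | refl | refl = ⊥-elim (ℕ.<-irrefl refl i<j)
    sat : Saturated (true ∷ zeros g ++ true ∷ [])
    sat {zero} _ ()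
    sat {suc k} (s≤s k<len) uk vac with vac {0} refl | vac {suc g} (at-zeros-++-∷ g)
    ... | inj₁ (s≤s b≤k) | inj₁ g+b<k = ℕ.<⇒≱ (ℕ.s<s⁻¹ g+b<k) (ℕ.≤-trans k≤g (ℕ.m≤m+n g b))
      where k≤g = <-length-zeros-∷ʳ k<len
    ... | inj₁ (s≤s b≤k) | inj₂ k+b<g =
      ℕ.<⇒≱ (ℕ.≤-<-trans (ℕ.+-monoˡ-≤ b b≤k) (ℕ.s<s⁻¹ k+b<g)) g≤b+b

  zeros-one⇔one : ∀ {a l} → a ≤ b → Jammedₗ (zeros a ++ true ∷ l) ⇔ Jammedₗ (true ∷ l)
  zeros-one⇔one {a} a≤b = mk⇔ (jammed-suffix (zeros a)) (jammed-glue (zeros a) (zeros-one-jammed a≤b))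

  one-zeros-one⇔one : ∀ {g l} → b ≤ g → g ≤ b + b →
                      Jammedₗ (true ∷ zeros g ++ true ∷ l) ⇔ Jammedₗ (true ∷ l)
  one-zeros-one⇔one {g} b≤g g≤b+b =
    mk⇔ (jammed-suffix (true ∷ zeros g)) (jammed-glue (true ∷ zeros g) (one-zeros-one-jammed b≤g g≤b+b))

-- Counting jammed completions of a prefix

module _ {A : Set} {P : Pred A 0ℓ} (P? : Decidable P) where

  length-filter-++ : ∀ xs ys → length (filter P? (xs ++ ys)) ≡ length (filter P? xs) + length (filter P? ys)
  length-filter-++ xs ys = trans (cong length (List.filter-++ P? xs ys)) (List.length-++ (filter P? xs))

  length-filter-map : ∀ {B : Set} (f : B → A) xs → length (filter P? (map f xs)) ≡ length (filter (P? ∘ f) xs)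
  length-filter-map f [] = refl
  length-filter-map f (x ∷ xs) with Dec.does (P? (f x))
  ... | true = cong suc (length-filter-map f xs)
  ... | false = length-filter-map f xs

  length-filter-none : (∀ x → ¬ P x) → ∀ xs → length (filter P? xs) ≡ 0
  length-filter-none ¬P xs = cong length (List.filter-none P? (universal ¬P xs))

constant-term : Series → Series
constant-term f N zero = f N zero
constant-term f N (suc L) = + 0

module _ (b : ℕ) where

  jammedₗ? : Decidable (Jammedₗ b)
  jammedₗ? u = Dec.map (subst (λ v → Jammed b (fromList u) ⇔ Jammedₗ b v) (Vec.toList∘fromList u)
                              (jammed⇔jammedₗ b (fromList u)))
                       (jammed? b (fromList u))

  Completes : List Bool → ℕ → ∀ {L} → Word L → Set
  Completes u N w = Jammedₗ b (u ++ toList w) × ones w ≡ N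

  completes? : ∀ u N {L} → Decidable (Completes u N {L})
  completes? u N w = jammedₗ? (u ++ toList w) ×-dec (ones w ℕ.≟ N)

  completions : List Bool → Series
  completions u N L = + length (filter (completes? u N) (allWords L))

  completions-step : ∀ u → completions u ≈ constant-term (completions u) ⊕ y· completions (u ∷ʳ false)
                                                                    ⊕ x· y· completions (u ∷ʳ true)
  completions-step u zero zero = sym (trans (ℤ.+-identityʳ _) (ℤ.+-identityʳ (completions u 0 0)))
  completions-step u (suc N) zero = sym (trans (ℤ.+-identityʳ _) (ℤ.+-identityʳ (completions u (suc N) 0)))
  completions-step u N (suc L) = begin
    + length (filter (completes? u N) (map (false ∷_) W ++ map (true ∷_) W))
      ≡⟨ cong +_ (trans (length-filter-++ (completes? u N) (map (false ∷_) W) (map (true ∷_) W))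
                        (cong₂ _+_ (length-filter-map (completes? u N) (false ∷_) W)
                                   (length-filter-map (completes? u N) (true ∷_) W))) ⟩
    + (length (filter (completes? u N ∘ (false ∷_)) W) + length (filter (completes? u N ∘ (true ∷_)) W))
      ≡⟨ ℤ.pos-+ (length (filter (completes? u N ∘ (false ∷_)) W)) _ ⟩
    + length (filter (completes? u N ∘ (false ∷_)) W) +ℤ + length (filter (completes? u N ∘ (true ∷_)) W)
      ≡⟨ cong₂ _+ℤ_ (trans (cong +_ zero-branch) (sym (ℤ.+-identityˡ (completions (u ∷ʳ false) N L))))
                    (one-branch N) ⟩
    + 0 +ℤ completions (u ∷ʳ false) N L +ℤ (x· y· completions (u ∷ʳ true)) N (suc L) ∎
    where
    open ≡-Reasoning
    W = allWords L
    zero-branch : length (filter (completes? u N ∘ (false ∷_)) W) ≡ length (filter (completes? (u ∷ʳ false) N) W)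
    zero-branch = cong length (List.filter-≐ _ _
      ((λ {w} (j , o) → subst (Jammedₗ b) (sym (List.∷ʳ-++ u false (toList w))) j , o) ,
       (λ {w} (j , o) → subst (Jammedₗ b) (List.∷ʳ-++ u false (toList w)) j , o)) W)
    one-branch : ∀ N → + length (filter (completes? u N ∘ (true ∷_)) W) ≡ (x· y· completions (u ∷ʳ true)) N (suc L)
    one-branch zero = cong +_ (length-filter-none _ (λ _ ()) W)
    one-branch (suc N) = cong +_ (cong length (List.filter-≐ _ _
      ((λ {w} (j , o) → subst (Jammedₗ b) (sym (List.∷ʳ-++ u true (toList w))) j , ℕ.suc-injective o) ,
       (λ {w} (j , o) → subst (Jammedₗ b) (List.∷ʳ-++ u true (toList w)) j , cong suc o)) W))

  constant-term-jammed : ∀ u → Jammedₗ b u → constant-term (completions u) ≈ 𝟙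
  constant-term-jammed u j zero zero =
    cong (λ ws → + length ws) (List.filter-accept (completes? u 0) (subst (Jammedₗ b) (sym (List.++-identityʳ u)) j , refl))
  constant-term-jammed u j (suc N) zero = cong (λ ws → + length ws) (List.filter-reject (completes? u (suc N)) λ ())
  constant-term-jammed u j zero (suc L) = refl
  constant-term-jammed u j (suc N) (suc L) = refl

  constant-term-unjammed : ∀ u → ¬ Jammedₗ b u → constant-term (completions u) ≈ 𝟘
  constant-term-unjammed u ¬j N zero = cong (λ ws → + length ws)
    (List.filter-reject (completes? u N) (λ (j , _) → ¬j (subst (Jammedₗ b) (List.++-identityʳ u) j)))
  constant-term-unjammed u ¬j N (suc L) = refl

  F≈completions[] : F b ≈ completions []
  F≈completions[] N L = cong (λ ws → + length ws) (List.filter-≐ _ _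
    ((λ {w} (j , o) → Equivalence.to (jammed⇔jammedₗ b w) j , o) ,
     (λ {w} (j , o) → Equivalence.from (jammed⇔jammedₗ b w) j , o)) (allWords L))

  completions-⇔ : ∀ u v → (∀ l → Jammedₗ b (u ++ l) ⇔ Jammedₗ b (v ++ l)) → completions u ≈ completions v
  completions-⇔ u v u⇔v N L = cong (λ ws → + length ws) (List.filter-≐ _ _
    ((λ {w} (j , o) → Equivalence.to (u⇔v (toList w)) j , o) ,
     (λ {w} (j , o) → Equivalence.from (u⇔v (toList w)) j , o)) (allWords L))

  completions-dead : ∀ u → (∀ l → ¬ Jammedₗ b (u ++ l)) → completions u ≈ 𝟘
  completions-dead u dead N L =
    cong +_ (length-filter-none (completes? u N) (λ w → dead (toList w) ∘ proj₁) (allWords L))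

-- Solving the recurrences

module Solution (b : ℕ) where

  Z O : ℕ → Series
  Z a = completions b (zeros a)
  O g = completions b (true ∷ zeros g)

  E : Series
  E = x· y· O 0

  R : Series
  R = 𝟙 ⊖ y^ (b + 1) · 𝟙

  step : ∀ u {I C D} → constant-term (completions b u) ≈ I → completions b (u ∷ʳ false) ≈ C →
         completions b (u ∷ʳ true) ≈ D → completions b u ≈ I ⊕ y· C ⊕ x· y· D
  step u eI eC eD = ≈-trans (completions-step b u) (⊕-cong (⊕-cong eI (y·-cong eC)) (x·-cong (y·-cong eD)))

  then-one : ∀ u → (∀ {l} → Jammedₗ b (u ++ true ∷ l) ⇔ Jammedₗ b (true ∷ l)) →
             completions b (u ∷ʳ true) ≈ O 0
  then-one u u1⇔1 =
    completions-⇔ b (u ∷ʳ true) (true ∷ [])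
      (λ l → subst (λ v → Jammedₗ b v ⇔ Jammedₗ b (true ∷ l)) (sym (List.∷ʳ-++ u true l)) u1⇔1)

  then-zero : ∀ u {a} → u ∷ʳ false ≡ a → completions b (u ∷ʳ false) ≈ completions b a
  then-zero u refl = ≈-refl

  drop-𝟘 : ∀ f → 𝟘 ⊕ f ⊕ E ≈ f ⊕ E
  drop-𝟘 f N L = cong (_+ℤ E N L) (ℤ.+-identityˡ (f N L))

  Z-step : ∀ k → k < b → Z (suc k) ≈ y· Z (suc (suc k)) ⊕ E
  Z-step k k<b = ≈-trans
    (step (zeros (suc k)) (constant-term-unjammed b (zeros (suc k)) (zeros-unjammed b k))
          (then-zero (zeros (suc k)) (zeros-∷ʳ (suc k)))
          (then-one (zeros (suc k)) (zeros-one⇔one b k<b)))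
    (drop-𝟘 (y· Z (suc (suc k))))

  Z-dead : Z (suc b) ≈ 𝟘
  Z-dead = completions-dead b (zeros (suc b)) (λ _ → long-zeros b (ℕ.n<1+n b))

  Z-0 : Z 0 ≈ 𝟙 ⊕ y· Z 1 ⊕ E
  Z-0 = step [] (constant-term-jammed b [] ([]-jammed b)) ≈-refl (then-one [] (zeros-one⇔one b z≤n))

  O-step-above : ∀ k → k < b → O (k + suc b) ≈ y· O (suc k + suc b) ⊕ E
  O-step-above k k<b = ≈-trans
    (step (true ∷ zeros g) (constant-term-unjammed b (true ∷ zeros g) (one-zeros-unjammed b b<g))
          (then-zero (true ∷ zeros g) (cong (true ∷_) (zeros-∷ʳ g)))
          (then-one (true ∷ zeros g) (one-zeros-one⇔one b (ℕ.<⇒≤ b<g) g≤b+b)))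
    (drop-𝟘 (y· O (suc g)))
    where
    g = k + suc b
    b<g = ℕ.<-≤-trans (ℕ.n<1+n b) (ℕ.m≤n+m (suc b) k)
    g≤b+b = subst (_≤ b + b) (sym (ℕ.+-suc k b)) (ℕ.+-monoˡ-≤ b k<b)

  O-dead : O (b + suc b) ≈ 𝟘
  O-dead = completions-dead b (true ∷ zeros (b + suc b)) (λ _ → long-gap b (ℕ.+-monoʳ-< b (ℕ.n<1+n b)))

  O-top : O b ≈ 𝟙 ⊕ y· O (suc b) ⊕ E
  O-top = step (true ∷ zeros b) (constant-term-jammed b (true ∷ zeros b) (one-zeros-jammed b ℕ.≤-refl))
               (then-zero (true ∷ zeros b) (cong (true ∷_) (zeros-∷ʳ b)))
               (then-one (true ∷ zeros b) (one-zeros-one⇔one b ℕ.≤-refl (ℕ.m≤m+n b b)))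

  O-step-below : ∀ k → k < b → O k ≈ y· O (suc k) ⊕ 𝟙
  O-step-below k k<b = ≈-trans
    (step (true ∷ zeros k) (constant-term-jammed b (true ∷ zeros k) (one-zeros-jammed b (ℕ.<⇒≤ k<b)))
          (then-zero (true ∷ zeros k) (cong (true ∷_) (zeros-∷ʳ k)))
          (completions-dead b (true ∷ zeros k ∷ʳ true)
            (λ l → short-gap b k<b ∘ proj₁ ∘ subst (Jammedₗ b) (List.∷ʳ-++ (true ∷ zeros k) true l))))
    (drop-x·y·𝟘 𝟙 (y· O (suc k)))
    where
    drop-x·y·𝟘 : ∀ f g → f ⊕ g ⊕ x· y· 𝟘 ≈ g ⊕ f
    drop-x·y·𝟘 f g N L =
      trans (cong ((f ⊕ g) N L +ℤ_) (multiplier-𝟘 (∘-multiplier x·-multiplier y·-multiplier) N L))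
            (trans (ℤ.+-identityʳ ((f ⊕ g) N L)) (ℤ.+-comm (f N L) (g N L)))

  Z1≈ : Z 1 ≈ geometric b E
  Z1≈ = geometric-dead-end b (Z ∘ suc) Z-step Z-dead

  O-suc-b≈ : O (suc b) ≈ geometric b E
  O-suc-b≈ = geometric-dead-end b (λ k → O (k + suc b)) O-step-above O-dead

  [1-y]-head : ∀ {H C} → H ≈ 𝟙 ⊕ y· C ⊕ E → C ≈ geometric b E →
               [1-y]· H ≈ [1-y]· 𝟙 ⊕ (E ⊖ y^ suc b · E)
  [1-y]-head {H} {C} H≈ C≈ = begin
    [1-y]· H                                ≈⟨ ·-cong H≈′ ⟩
    [1-y]· (𝟙 ⊕ geometric (suc b) E)       ≈⟨ ⊕-homo 𝟙 (geometric (suc b) E) ⟩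
    [1-y]· 𝟙 ⊕ [1-y]· geometric (suc b) E  ≈⟨ ⊕-cong (≈-refl {[1-y]· 𝟙}) ([1-y]-geometric (suc b) E) ⟩
    [1-y]· 𝟙 ⊕ (E ⊖ y^ suc b · E)          ∎
    where
    open ≈-Reasoning
    open Multiplier [1-y]-multiplier
    H≈′ : H ≈ 𝟙 ⊕ geometric (suc b) E
    H≈′ N L = trans (H≈ N L) (trans (cong (λ v → 𝟙 N L +ℤ v +ℤ E N L) (y·-cong C≈ N L))
                                    (ℤ.+-assoc (𝟙 N L) ((y· geometric b E) N L) (E N L)))

  X₁ X₂ : Series
  X₁ = x· y^ (b + 1) · O 0
  X₂ = x· y^ (2 ℕ.* b + 2) · O 0

  [1-y]-O0 : [1-y]· O 0 ≈ (y^ b · 𝟙 ⊖ y^ (b + 1) · 𝟙) ⊕ (X₁ ⊖ X₂) ⊕ (𝟙 ⊖ y^ b · 𝟙)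
  [1-y]-O0 = begin
    [1-y]· O 0
      ≈⟨ Q.·-cong (geometric-chain b O O-step-below) ⟩
    [1-y]· (y^ b · O b ⊕ geometric b 𝟙)
      ≈⟨ Q.⊕-homo (y^ b · O b) (geometric b 𝟙) ⟩
    [1-y]· y^ b · O b ⊕ [1-y]· geometric b 𝟙
      ≈⟨ ⊕-cong (≈-trans (y^-comm [1-y]-multiplier b (O b)) (Yᵇ.·-cong ([1-y]-head O-top O-suc-b≈)))
                ([1-y]-geometric b 𝟙) ⟩
    y^ b · ([1-y]· 𝟙 ⊕ (E ⊖ y^ suc b · E)) ⊕ (𝟙 ⊖ y^ b · 𝟙)
      ≈⟨ ⊕-cong (≈-trans (Yᵇ.⊕-homo ([1-y]· 𝟙) (E ⊖ y^ suc b · E)) (⊕-cong Yᵇ-[1-y] Yᵇ-tail))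
                (≈-refl {𝟙 ⊖ y^ b · 𝟙}) ⟩
    (y^ b · 𝟙 ⊖ y^ (b + 1) · 𝟙) ⊕ (X₁ ⊖ X₂) ⊕ (𝟙 ⊖ y^ b · 𝟙) ∎
    where
    open ≈-Reasoning
    module Q = Multiplier [1-y]-multiplier
    module Yᵇ = Multiplier (y^-multiplier b)
    Yᵇ-[1-y] : y^ b · [1-y]· 𝟙 ≈ y^ b · 𝟙 ⊖ y^ (b + 1) · 𝟙
    Yᵇ-[1-y] = ≈-trans (Yᵇ.⊖-homo 𝟙 (y· 𝟙)) (⊖-cong (≈-refl {y^ b · 𝟙}) (y^-+ b 1 𝟙))
    exponent : ∀ b → b + suc b + 1 ≡ 2 ℕ.* b + 2
    exponent = ℕ-Ring.solve-∀
    Yᵇ-tail : y^ b · (E ⊖ y^ suc b · E) ≈ X₁ ⊖ X₂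
    Yᵇ-tail = ≈-trans (Yᵇ.⊖-homo E (y^ suc b · E))
                      (⊖-cong (y^-x·y^ b 1 (O 0))
                              (≈-trans (y^-+ b (suc b) E)
                                       (≈-trans (y^-x·y^ (b + suc b) 1 (O 0)) (x·y^-≡ (exponent b) (O 0)))))

  P-O0 : P[ b ]· O 0 ≈ R
  P-O0 N L = trans (cong (λ v → v +ℤ -ℤ X₁ N L +ℤ X₂ N L) ([1-y]-O0 N L))
                   (cancel ((y^ b · 𝟙) N L) ((y^ (b + 1) · 𝟙) N L) (X₁ N L) (X₂ N L) (𝟙 N L))
    where
    cancel : ∀ p q s t o → (p +ℤ -ℤ q) +ℤ (s +ℤ -ℤ t) +ℤ (o +ℤ -ℤ p) +ℤ -ℤ s +ℤ t ≡ o +ℤ -ℤ q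
    cancel = solve-∀

  P-E : P[ b ]· E ≈ x· y· R
  P-E = ≈-trans (x·-comm (y· O 0)) (x·-cong (≈-trans (y·-comm (O 0)) (y·-cong P-O0)))
    where open Multiplier (P-multiplier b)

  P[1-y]-F : P[ b ]· [1-y]· F b ≈ P[ b ]· [1-y]· 𝟙 ⊕ (x· y· R ⊖ y^ suc b · x· y· R)
  P[1-y]-F = begin
    P[ b ]· [1-y]· F b
      ≈⟨ P.·-cong (Q.·-cong (F≈completions[] b)) ⟩
    P[ b ]· [1-y]· Z 0
      ≈⟨ P.·-cong ([1-y]-head Z-0 Z1≈) ⟩
    P[ b ]· ([1-y]· 𝟙 ⊕ (E ⊖ y^ suc b · E))
      ≈⟨ ≈-trans (P.⊕-homo ([1-y]· 𝟙) (E ⊖ y^ suc b · E)) (⊕-cong (≈-refl {P[ b ]· [1-y]· 𝟙}) P-tail) ⟩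
    P[ b ]· [1-y]· 𝟙 ⊕ (x· y· R ⊖ y^ suc b · x· y· R) ∎
    where
    open ≈-Reasoning
    module P = Multiplier (P-multiplier b)
    module Q = Multiplier [1-y]-multiplier
    P-tail : P[ b ]· (E ⊖ y^ suc b · E) ≈ x· y· R ⊖ y^ suc b · x· y· R
    P-tail = ≈-trans (P.⊖-homo E (y^ suc b · E))
                     (⊖-cong P-E (≈-trans (y^-comm (P-multiplier b) (suc b) E)
                                          (Multiplier.·-cong (y^-multiplier (suc b)) P-E)))

  numer-≈-solution : numer b ≈ P[ b ]· [1-y]· 𝟙 ⊕ (x· y· R ⊖ y^ suc b · x· y· R)
  numer-≈-solution = begin
    numer b
      ≈⟨ numer-≈ b ⟩
    [1-y]· [1-y]· 𝟙 ⊕ e 1 ⊖ e (b + 1) ⊖ e (b + 2) ⊕ e (2 ℕ.* b + 2)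
      ≈⟨ (λ N L → rearrange (([1-y]· [1-y]· 𝟙) N L) (e 1 N L) (e (b + 1) N L) (e (b + 2) N L)
                            (e (2 ℕ.* b + 2) N L) (e (2 ℕ.* b + 2 + 1) N L)) ⟩
    [1-y]· [1-y]· 𝟙 ⊖ (e (b + 1) ⊖ e (b + 2)) ⊕ (e (2 ℕ.* b + 2) ⊖ e (2 ℕ.* b + 2 + 1))
      ⊕ ((e 1 ⊖ e (b + 2)) ⊖ (e (b + 2) ⊖ e (2 ℕ.* b + 2 + 1)))
      ≈⟨ ≈-sym (⊕-cong (⊕-cong (⊖-cong (≈-refl {[1-y]· [1-y]· 𝟙}) x·y^b+1-[1-y]≈) (x·y^-[1-y] (2 ℕ.* b + 2)))
                       (⊖-cong x·y·R≈ y^suc-b-x·y·R≈)) ⟩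
    P[ b ]· [1-y]· 𝟙 ⊕ (x· y· R ⊖ y^ suc b · x· y· R) ∎
    where
    open ≈-Reasoning
    e : ℕ → Series
    e k = x· y^ k · 𝟙
    x·y^-[1-y] : ∀ k → x· y^ k · [1-y]· 𝟙 ≈ e k ⊖ e (k + 1)
    x·y^-[1-y] k = ≈-trans (Multiplier.⊖-homo (x·y^-multiplier k) 𝟙 (y· 𝟙))
                           (⊖-cong (≈-refl {e k}) (x·-cong (y^-+ k 1 𝟙)))
    x·y^b+1-[1-y]≈ : x· y^ (b + 1) · [1-y]· 𝟙 ≈ e (b + 1) ⊖ e (b + 2)
    x·y^b+1-[1-y]≈ = ≈-trans (x·y^-[1-y] (b + 1)) (⊖-cong (≈-refl {e (b + 1)}) (x·y^-≡ (ℕ.+-assoc b 1 1) 𝟙))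
    1+[b+1]≡b+2 : suc (b + 1) ≡ b + 2
    1+[b+1]≡b+2 = sym (ℕ.+-suc b 1)
    x·y·R≈ : x· y· R ≈ e 1 ⊖ e (b + 2)
    x·y·R≈ = ≈-trans (Multiplier.⊖-homo (x·y^-multiplier 1) 𝟙 (y^ (b + 1) · 𝟙))
                     (⊖-cong (≈-refl {e 1}) (≈-trans (x·-cong (y^-+ 1 (b + 1) 𝟙)) (x·y^-≡ 1+[b+1]≡b+2 𝟙)))
    exponent : ∀ b → suc b + 1 + (b + 1) ≡ 2 ℕ.* b + 2 + 1
    exponent = ℕ-Ring.solve-∀
    y^suc-b-x·y·R≈ : y^ suc b · x· y· R ≈ e (b + 2) ⊖ e (2 ℕ.* b + 2 + 1)
    y^suc-b-x·y·R≈ =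
      ≈-trans (y^-x·y^ (suc b) 1 R)
              (≈-trans (Multiplier.⊖-homo (x·y^-multiplier (suc b + 1)) 𝟙 (y^ (b + 1) · 𝟙))
                       (⊖-cong (x·y^-≡ 1+[b+1]≡b+2 𝟙)
                               (≈-trans (x·-cong (y^-+ (suc b + 1) (b + 1) 𝟙)) (x·y^-≡ (exponent b) 𝟙))))
    rearrange : ∀ q p u v w z → q +ℤ p +ℤ -ℤ u +ℤ -ℤ v +ℤ w
                                ≡ q +ℤ -ℤ (u +ℤ -ℤ v) +ℤ (w +ℤ -ℤ z) +ℤ ((p +ℤ -ℤ v) +ℤ -ℤ (v +ℤ -ℤ z))
    rearrange = solve-∀

jammed-generating-function : ∀ b → F b ⊗ denom b ≈ numer b
jammed-generating-function b = begin
  F b ⊗ denom b                                       ≈⟨ ⊗-denom b (F b) ⟩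
  P[ b ]· [1-y]· F b                                  ≈⟨ P[1-y]-F ⟩
  P[ b ]· [1-y]· 𝟙 ⊕ (x· y· R ⊖ y^ suc b · x· y· R)  ≈⟨ ≈-sym numer-≈-solution ⟩
  numer b                                             ∎
  where
  open ≈-Reasoning
  open Solution b

lemma2p1 : (b : ℕ) → 1 ≤ b → (N L : ℕ) → (F b ⊗ denom b) N L ≡ numer b N L
lemma2p1 b _ = jammed-generating-function b
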